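{- A rooted labeled forest that avoids the pattern $123$ avoids the pattern $3142$ if and only if it is a $P_2$-forest.
   Context: Rooted labeled forest: an unordered forest whose components have distinguished roots and whose vertices carry distinct integer labels $L(v)$. An instance of a pattern $\pi$ of length $k$ (a permutation of $[k]$) is a sequence $v_1,\dots,v_k$ with $v_i$ a strict ancestor of $v_{i+1}$ and labels in the same relative order as $\pi$; avoiding means having no instance. Ancestors of $v$ include $v$. A vertex $v$ is a top-down minimum (TDM) if $L(u)\ge L(v)$ for all ancestors $u$ of $v$; otherwise non-TDM. For a non-TDM vertex $v$, its segment is the set of TDM ancestors $u$ of $v$ with $L(u)<L(v)$; the top of $v$ (of its segment) is the vertex of the segment closest to the root, equivalently the one with the greatest label. Two vertices are comparable if one is an ancestor of the other. A $P_2$-forest is a forest in which, whenever two comparable non-TDM vertices have intersecting segments, their tops coincide. -}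

module Defs where

open import Data.Nat using (ℕ; suc)
open import Data.Fin using (Fin; toℕ)
open import Data.Maybe using (Maybe; just)
open import Data.Integer using (ℤ; _<_; _≤_)
open import Data.Product using (Σ; ∃; _×_)
open import Data.Sum using (_⊎_)
open import Data.Vec using (Vec; lookup; _∷_; [])
open import Relation.Nullary using (¬_)
open import Relation.Binary.PropositionalEquality using (_≡_)
open import Function.Bundles using (_⇔_)
open import Function.Definitions using (Injective)

-- A rooted labeled forest on the vertex set Fin n.
-- parent v = nothing  means v is a root; parent v = just w means w is the parent of v.
-- StrictAnc u v : u is a strict ancestor of v.
data StrictAnc {n : ℕ} (parent : Fin n → Maybe (Fin n)) : Fin n → Fin n → Set where
  par  : ∀ {u v} → parent v ≡ just u → StrictAnc parent u v
  step : ∀ {u w v} → parent v ≡ just w → StrictAnc parent u w → StrictAnc parent u v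

record LabeledForest : Set where
  field
    n       : ℕ
    parent  : Fin n → Maybe (Fin n)
    acyclic : ∀ v → ¬ StrictAnc parent v v
    L       : Fin n → ℤ
    L-inj   : Injective _≡_ _≡_ L

module _ (F : LabeledForest) where
  open LabeledForest F

  Vertex : Set
  Vertex = Fin n

  _≺_ : Vertex → Vertex → Set
  u ≺ v = StrictAnc parent u v

  Anc : Vertex → Vertex → Set
  Anc u v = u ≡ v ⊎ u ≺ v

  Comparable : Vertex → Vertex → Set
  Comparable u v = Anc u v ⊎ Anc v u

  -- An instance of the pattern π (a permutation of [k], given by its values
  -- π(1),...,π(k) as a vector of naturals) is a sequence v₁,…,vₖ with vᵢ a strict
  -- ancestor of vᵢ₊₁ and labels in the same relative order as π.
  Instance : ∀ {k} → Vec ℕ k → (Fin k → Vertex) → Set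
  Instance {k} π vs =
    (∀ (i j : Fin k) → toℕ j ≡ suc (toℕ i) → vs i ≺ vs j) ×
    (∀ (i j : Fin k) → (lookup π i Data.Nat.< lookup π j) ⇔ (L (vs i) < L (vs j)))

  Contains : ∀ {k} → Vec ℕ k → Set
  Contains {k} π = Σ (Fin k → Vertex) (Instance π)

  Avoids : ∀ {k} → Vec ℕ k → Set
  Avoids π = ¬ Contains π

  TDM : Vertex → Set
  TDM v = ∀ u → Anc u v → L v ≤ L u

  InSegment : Vertex → Vertex → Set
  InSegment u v = TDM u × Anc u v × L u < L v

  IsTop : Vertex → Vertex → Set
  IsTop t v = InSegment t v × (∀ u → InSegment u v → Anc t u)

  IsP₂Forest : Set
  IsP₂Forest = ∀ v w → ¬ TDM v → ¬ TDM w → Comparable v w →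
    (∃ λ u → InSegment u v × InSegment u w) →
    ∀ t t' → IsTop t v → IsTop t' w → t ≡ t'

pat123 : Vec ℕ 3
pat123 = 1 ∷ 2 ∷ 3 ∷ []

pat3142 : Vec ℕ 4
pat3142 = 3 ∷ 1 ∷ 4 ∷ 2 ∷ []

-- Let v ⊏ w be non-TDM vertices whose segments share a vertex u, with tops t and t′.
-- Both tops lie above u, so they are comparable.  If t′ ⊏ t, then t′ is a TDM
-- ancestor of v outside its segment, so L t < L v < L t′ < L w and t, v, w form a
-- 123.  If t ⊏ t′, then symmetrically L w < L t, and t, t′, v, w form a 3142.
-- Conversely, a 3142 occurrence a, b, c, d in a 123-avoiding forest forces a to be
-- a TDM in the segment of c, while the minimum ancestor of b lies in the segments of
-- both c and d; a common top would then be an ancestor of a with label below L a.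
module Submission where

open import Defs
open import Function.Bundles using (_⇔_; mk⇔; Equivalence)
open import Data.Nat as ℕ using (ℕ; suc; _<ᵇ_)
import Data.Nat.Properties as ℕ
open import Data.Fin using (Fin; zero; suc; toℕ; inject₁)
open import Data.Fin.Properties as Fin using (toℕ-injective; toℕ-inject₁; all?)
open import Data.Fin.Induction using (spo-wellFounded)
open import Data.Maybe using (just; nothing)
open import Data.Maybe.Properties using (just-injective)
open import Data.Integer using (_<_; _≤_)
open import Data.Integer.Properties
  using (<-irrefl; <-asym; <-trans; <-≤-trans; ≤-<-trans; ≤-refl; ≤-trans;
         _≤?_; _<?_; ≮⇒≥; ≰⇒>; <⇒≤; <⇒≱; ≤∧≢⇒<)
open import Data.Product using (∃; _×_; _,_; proj₁; proj₂)
open import Data.Sum using (_⊎_; inj₁; inj₂)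
open import Data.Unit using (tt)
open import Data.Bool using (T)
open import Data.Empty using (⊥; ⊥-elim)
open import Data.Vec using (Vec; lookup; _∷_; [])
open import Function using (_∘_; case_of_)
open import Induction.WellFounded using (WellFounded; Acc; acc)
open import Relation.Binary using (IsStrictPartialOrder; tri<; tri≈; tri>)
open import Relation.Binary.PropositionalEquality
  using (_≡_; refl; sym; trans; cong; subst; isEquivalence; resp₂)
open import Relation.Nullary using (¬_; Dec; yes; no)
open import Relation.Nullary.Decidable using (_×-dec_; _→-dec_; toWitness)
open import Relation.Unary using (Decidable)

PatternInjective : ∀ {k} → Vec ℕ k → Set
PatternInjective π = ∀ i j → lookup π i ≡ lookup π j → i ≡ j

patternInjective? : ∀ {k} (π : Vec ℕ k) → Dec (PatternInjective π)
patternInjective? π =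
  all? λ i → all? λ j → (lookup π i ℕ.≟ lookup π j) →-dec (i Fin.≟ j)

pat123-injective : PatternInjective pat123
pat123-injective = toWitness {a? = patternInjective? pat123} tt

pat3142-injective : PatternInjective pat3142
pat3142-injective = toWitness {a? = patternInjective? pat3142} tt

module _ (F : LabeledForest) where
  open LabeledForest F

  infix 4 _⊏_ _⊑_

  _⊏_ : Vertex F → Vertex F → Set
  _⊏_ = Defs._≺_ F

  _⊑_ : Vertex F → Vertex F → Set
  _⊑_ = Anc F

  private
    variable
      a b c d m t t′ u v w x y : Vertex F

  ⊏-trans : x ⊏ y → y ⊏ w → x ⊏ w
  ⊏-trans x⊏y (par e)      = step e x⊏y
  ⊏-trans x⊏y (step e y⊏p) = step e (⊏-trans x⊏y y⊏p)

  ⊏-⊑-trans : x ⊏ y → y ⊑ w → x ⊏ w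
  ⊏-⊑-trans x⊏y (inj₁ refl) = x⊏y
  ⊏-⊑-trans x⊏y (inj₂ y⊏w)  = ⊏-trans x⊏y y⊏w

  ⊑-trans : x ⊑ y → y ⊑ w → x ⊑ w
  ⊑-trans (inj₁ refl) y⊑w = y⊑w
  ⊑-trans (inj₂ x⊏y)  y⊑w = inj₂ (⊏-⊑-trans x⊏y y⊑w)

  ⊏⇒⋣ : x ⊏ y → ¬ y ⊑ x
  ⊏⇒⋣ x⊏y y⊑x = acyclic _ (⊏-⊑-trans x⊏y y⊑x)

  ⊑-antisym : x ⊑ y → y ⊑ x → x ≡ y
  ⊑-antisym (inj₁ x≡y) _   = x≡y
  ⊑-antisym (inj₂ x⊏y) y⊑x = ⊥-elim (⊏⇒⋣ x⊏y y⊑x)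

  ⊏-root : parent v ≡ nothing → ¬ x ⊏ v
  ⊏-root e (par e′)    = case trans (sym e) e′ of λ ()
  ⊏-root e (step e′ _) = case trans (sym e) e′ of λ ()

  ⊑-parent⇒⊏ : parent v ≡ just w → x ⊑ w → x ⊏ v
  ⊑-parent⇒⊏ e (inj₁ refl) = par e
  ⊑-parent⇒⊏ e (inj₂ x⊏w)  = step e x⊏w

  ⊏⇒⊑-parent : parent v ≡ just w → x ⊏ v → x ⊑ w
  ⊏⇒⊑-parent e (par e′) with just-injective (trans (sym e′) e)
  ... | refl = inj₁ refl
  ⊏⇒⊑-parent e (step e′ x⊏p) with just-injective (trans (sym e′) e)
  ... | refl = inj₂ x⊏p

  ⊏-comparable : x ⊏ w → y ⊑ w → Comparable F x y
  ⊏-comparable x⊏w          (inj₁ refl) = inj₁ (inj₂ x⊏w)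
  ⊏-comparable (par e)      (inj₂ y⊏w)  = inj₂ (⊏⇒⊑-parent e y⊏w)
  ⊏-comparable (step e x⊏p) (inj₂ y⊏w)  = ⊏-comparable x⊏p (⊏⇒⊑-parent e y⊏w)

  ⊑-comparable : x ⊑ w → y ⊑ w → Comparable F x y
  ⊑-comparable (inj₁ refl) y⊑w = inj₂ y⊑w
  ⊑-comparable (inj₂ x⊏w)  y⊑w = ⊏-comparable x⊏w y⊑w

  ⊏-isStrictPartialOrder : IsStrictPartialOrder _≡_ _⊏_
  ⊏-isStrictPartialOrder = record
    { isEquivalence = isEquivalence
    ; irrefl        = λ { refl → acyclic _ }
    ; trans         = ⊏-trans
    ; <-resp-≈      = resp₂ _⊏_
    }

  ⊏-wellFounded : WellFounded _⊏_
  ⊏-wellFounded = spo-wellFounded ⊏-isStrictPartialOrder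

  parent-induction : (P : Vertex F → Set) →
    (∀ {v} → parent v ≡ nothing → P v) →
    (∀ {v w} → parent v ≡ just w → P w → P v) →
    ∀ v → P v
  parent-induction P root child v = go (⊏-wellFounded v)
    where
    go : ∀ {v} → Acc _⊏_ v → P v
    go {v} (acc rs) with parent v in e
    ... | nothing = root e
    ... | just w  = child e (go (rs (par e)))

  IsMinAncestor : Vertex F → Vertex F → Set
  IsMinAncestor m v = m ⊑ v × (∀ x → x ⊑ v → L m ≤ L x)

  minAncestor : ∀ v → ∃ λ m → IsMinAncestor m v
  minAncestor = parent-induction _ atRoot atChild
    where
    atRoot : parent v ≡ nothing → ∃ λ m → IsMinAncestor m v
    atRoot {v} e = v , inj₁ refl , λ
      { x (inj₁ refl) → ≤-refl
      ; x (inj₂ x⊏v)  → ⊥-elim (⊏-root e x⊏v) }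

    atChild : parent v ≡ just w → ∃ (λ m → IsMinAncestor m w) → ∃ λ m → IsMinAncestor m v
    atChild {v} e (m , m⊑w , m-min) with L v ≤? L m
    ... | yes v≤m = v , inj₁ refl , λ
      { x (inj₁ refl) → ≤-refl
      ; x (inj₂ x⊏v)  → ≤-trans v≤m (m-min x (⊏⇒⊑-parent e x⊏v)) }
    ... | no v≰m = m , inj₂ (⊑-parent⇒⊏ e m⊑w) , λ
      { x (inj₁ refl) → <⇒≤ (≰⇒> v≰m)
      ; x (inj₂ x⊏v)  → m-min x (⊏⇒⊑-parent e x⊏v) }

  minAncestor⇒TDM : IsMinAncestor m v → TDM F m
  minAncestor⇒TDM (m⊑v , m-min) u u⊑m = m-min u (⊑-trans u⊑m m⊑v)

  minAncestor∈segment : IsMinAncestor m x → x ⊑ v → L x < L v → InSegment F m v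
  minAncestor∈segment min@(m⊑x , m-min) x⊑v x<v =
    minAncestor⇒TDM min , ⊑-trans m⊑x x⊑v , ≤-<-trans (m-min _ (inj₁ refl)) x<v

  ≤minAncestor⇒TDM : IsMinAncestor m v → L v ≤ L m → TDM F v
  ≤minAncestor⇒TDM (_ , m-min) v≤m u u⊑v = ≤-trans v≤m (m-min u u⊑v)

  ¬TDM⇒minAncestor< : IsMinAncestor m v → ¬ TDM F v → L m < L v
  ¬TDM⇒minAncestor< min ¬tdm = ≰⇒> (¬tdm ∘ ≤minAncestor⇒TDM min)

  TDM? : Decidable (TDM F)
  TDM? v with minAncestor v
  ... | m , min with L v ≤? L m
  ... | yes v≤m = yes (≤minAncestor⇒TDM min v≤m)
  ... | no v≰m  = no λ v-tdm → v≰m (v-tdm m (proj₁ min))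

  smaller-ancestor⇒¬TDM : x ⊏ v → L x < L v → ¬ TDM F v
  smaller-ancestor⇒¬TDM x⊏v x<v v-tdm = <⇒≱ x<v (v-tdm _ (inj₂ x⊏v))

  TDM⊑¬TDM⇒⊏ : x ⊑ y → TDM F x → ¬ TDM F y → x ⊏ y
  TDM⊑¬TDM⇒⊏ (inj₁ refl) x-tdm ¬y-tdm = ⊥-elim (¬y-tdm x-tdm)
  TDM⊑¬TDM⇒⊏ (inj₂ x⊏y)  _     _      = x⊏y

  IsHighestAncestor : (Vertex F → Set) → Vertex F → Vertex F → Set
  IsHighestAncestor P t v = t ⊑ v × P t × (∀ u → u ⊑ v → P u → t ⊑ u)

  highestAncestor : (P : Vertex F → Set) → Decidable P → ∀ v →
    (∃ λ t → IsHighestAncestor P t v) ⊎ (∀ u → u ⊑ v → ¬ P u)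
  highestAncestor P P? = parent-induction _ (λ e → selfIfNoneAbove λ u → ⊥-elim ∘ ⊏-root e) atChild
    where
    selfIfNoneAbove : (∀ u → u ⊏ v → ¬ P u) →
      (∃ λ t → IsHighestAncestor P t v) ⊎ (∀ u → u ⊑ v → ¬ P u)
    selfIfNoneAbove {v} none with P? v
    ... | yes pv = inj₁ (v , inj₁ refl , pv , λ
      { u (inj₁ refl) _  → inj₁ refl
      ; u (inj₂ u⊏v)  pu → ⊥-elim (none u u⊏v pu) })
    ... | no ¬pv = inj₂ λ
      { u (inj₁ refl) → ¬pv
      ; u (inj₂ u⊏v)  → none u u⊏v }

    atChild : parent v ≡ just w →
      (∃ λ t → IsHighestAncestor P t w) ⊎ (∀ u → u ⊑ w → ¬ P u) →
      (∃ λ t → IsHighestAncestor P t v) ⊎ (∀ u → u ⊑ v → ¬ P u)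
    atChild e (inj₁ (t , t⊑w , pt , t-highest)) = inj₁ (t , t⊑v , pt , λ
      { u (inj₁ refl) _  → t⊑v
      ; u (inj₂ u⊏v)  pu → t-highest u (⊏⇒⊑-parent e u⊏v) pu })
      where t⊑v = inj₂ (⊑-parent⇒⊏ e t⊑w)
    atChild e (inj₂ none) = selfIfNoneAbove λ u u⊏v → none u (⊏⇒⊑-parent e u⊏v)

  top-exists : ¬ TDM F v → ∃ λ t → IsTop F t v
  top-exists {v} ¬tdm
    with highestAncestor (λ u → TDM F u × L u < L v) (λ u → TDM? u ×-dec L u <? L v) v
  ... | inj₁ (t , t⊑v , (t-tdm , t<v) , t-highest) =
    t , (t-tdm , t⊑v , t<v) , λ u (u-tdm , u⊑v , u<v) → t-highest u u⊑v (u-tdm , u<v)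
  ... | inj₂ none with minAncestor v
  ... | m , min = ⊥-elim (none m (proj₁ min) (minAncestor⇒TDM min , ¬TDM⇒minAncestor< min ¬tdm))

  top⇒¬TDM : IsTop F t v → ¬ TDM F v
  top⇒¬TDM ((_ , t⊑v , t<v) , _) v-tdm = <⇒≱ t<v (v-tdm _ t⊑v)

  top-unique : IsTop F t v → IsTop F t′ v → t ≡ t′
  top-unique (t∈seg , t-highest) (t′∈seg , t′-highest) =
    ⊑-antisym (t-highest _ t′∈seg) (t′-highest _ t∈seg)

  -- A TDM ancestor above the top lies outside the segment, and it differs from v.
  above-top⇒> : IsTop F t v → TDM F x → x ⊏ t → L v < L x
  above-top⇒> ((_ , t⊑v , _) , t-highest) x-tdm x⊏t =
    ≤∧≢⇒< (≮⇒≥ λ x<v → ⊏⇒⋣ x⊏t (t-highest _ (x-tdm , inj₂ x⊏v , x<v)))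
          (λ Lv≡Lx → acyclic _ (subst (_⊏ _) (L-inj (sym Lv≡Lx)) x⊏v))
    where x⊏v = ⊏-⊑-trans x⊏t t⊑v

  -- Phrased with _<ᵇ_ so that, for a concrete pattern, the pairs with π i ≮ π j are
  -- dismissed by absurd patterns.
  Increasing : ∀ {k} → Vec ℕ k → (Fin k → Vertex F) → Set
  Increasing π vs = ∀ i j → T (lookup π i <ᵇ lookup π j) → L (vs i) < L (vs j)

  contains : ∀ {k} (π : Vec ℕ (suc k)) → PatternInjective π → (vs : Fin (suc k) → Vertex F) →
    (∀ i → vs (inject₁ i) ⊏ vs (suc i)) → Increasing π vs → Contains F π
  contains π π-inj vs consecutive increasing = vs , linked , sameOrder
    where
    linked : ∀ i j → toℕ j ≡ suc (toℕ i) → vs i ⊏ vs j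
    linked i (suc j) e
      with toℕ-injective {i = i} {j = inject₁ j} (trans (sym (ℕ.suc-injective e)) (sym (toℕ-inject₁ j)))
    ... | refl = consecutive j

    sameOrder : ∀ i j → (lookup π i ℕ.< lookup π j) ⇔ (L (vs i) < L (vs j))
    sameOrder i j = mk⇔ (increasing i j ∘ ℕ.<⇒<ᵇ) reflect
      where
      reflect : L (vs i) < L (vs j) → lookup π i ℕ.< lookup π j
      reflect vi<vj with ℕ.<-cmp (lookup π i) (lookup π j)
      ... | tri< πi<πj _ _ = πi<πj
      ... | tri≈ _ πi≡πj _ with π-inj i j πi≡πj
      ...   | refl = ⊥-elim (<-irrefl refl vi<vj)
      reflect vi<vj | tri> _ _ πj<πi = ⊥-elim (<-asym vi<vj (increasing j i (ℕ.<⇒<ᵇ πj<πi)))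

  instance⇒consecutive : ∀ {k} {π : Vec ℕ (suc k)} {vs} → Instance F π vs →
    ∀ i → vs (inject₁ i) ⊏ vs (suc i)
  instance⇒consecutive (linked , _) i = linked (inject₁ i) (suc i) (cong suc (sym (toℕ-inject₁ i)))

  instance⇒increasing : ∀ {k} {π : Vec ℕ k} {vs} → Instance F π vs → Increasing π vs
  instance⇒increasing {π = π} (_ , sameOrder) i j πi<πj =
    Equivalence.to (sameOrder i j) (ℕ.<ᵇ⇒< (lookup π i) (lookup π j) πi<πj)

  contains123 : x ⊏ y → y ⊏ w → L x < L y → L y < L w → Contains F pat123
  contains123 {x} {y} {w} x⊏y y⊏w x<y y<w =
    contains pat123 pat123-injective vs consecutive increasing
    where
    vs : Fin 3 → Vertex F
    vs = lookup (x ∷ y ∷ w ∷ [])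

    consecutive : ∀ i → vs (inject₁ i) ⊏ vs (suc i)
    consecutive zero       = x⊏y
    consecutive (suc zero) = y⊏w

    increasing : Increasing pat123 vs
    increasing zero             (suc zero)       _ = x<y
    increasing zero             (suc (suc zero)) _ = <-trans x<y y<w
    increasing (suc zero)       (suc (suc zero)) _ = y<w
    increasing zero             zero             ()
    increasing (suc zero)       zero             ()
    increasing (suc zero)       (suc zero)       ()
    increasing (suc (suc zero)) zero             ()
    increasing (suc (suc zero)) (suc zero)       ()
    increasing (suc (suc zero)) (suc (suc zero)) ()

  contains3142 : a ⊏ b → b ⊏ c → c ⊏ d → L b < L d → L d < L a → L a < L c → Contains F pat3142
  contains3142 {a} {b} {c} {d} a⊏b b⊏c c⊏d b<d d<a a<c =
    contains pat3142 pat3142-injective vs consecutive increasing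
    where
    vs : Fin 4 → Vertex F
    vs = lookup (a ∷ b ∷ c ∷ d ∷ [])

    consecutive : ∀ i → vs (inject₁ i) ⊏ vs (suc i)
    consecutive zero             = a⊏b
    consecutive (suc zero)       = b⊏c
    consecutive (suc (suc zero)) = c⊏d

    increasing : Increasing pat3142 vs
    increasing zero                   (suc (suc zero))       _ = a<c
    increasing (suc zero)             zero                   _ = <-trans b<d d<a
    increasing (suc zero)             (suc (suc zero))       _ = <-trans b<d (<-trans d<a a<c)
    increasing (suc zero)             (suc (suc (suc zero))) _ = b<d
    increasing (suc (suc (suc zero))) zero                   _ = d<a
    increasing (suc (suc (suc zero))) (suc (suc zero))       _ = <-trans d<a a<c
    increasing zero                   zero                   ()
    increasing zero                   (suc zero)             ()
    increasing zero                   (suc (suc (suc zero))) ()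
    increasing (suc zero)             (suc zero)             ()
    increasing (suc (suc zero))       zero                   ()
    increasing (suc (suc zero))       (suc zero)             ()
    increasing (suc (suc zero))       (suc (suc zero))       ()
    increasing (suc (suc zero))       (suc (suc (suc zero))) ()
    increasing (suc (suc (suc zero))) (suc zero)             ()
    increasing (suc (suc (suc zero))) (suc (suc (suc zero))) ()

  avoids123⇒TDM : Avoids F pat123 → x ⊏ y → L x < L y → TDM F x
  avoids123⇒TDM avoids x⊏y x<y u (inj₁ refl) = ≤-refl
  avoids123⇒TDM avoids x⊏y x<y u (inj₂ u⊏x)  = ≮⇒≥ λ u<x → avoids (contains123 u⊏x x⊏y u<x x<y)

  no3142-in-P₂ : Avoids F pat123 → IsP₂Forest F →
    a ⊏ b → b ⊏ c → c ⊏ d → L b < L d → L d < L a → L a < L c → ⊥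
  no3142-in-P₂ {a} {b} {c} {d} avoids p₂ a⊏b b⊏c c⊏d b<d d<a a<c =
    let m , m-min = minAncestor b
        t , c-top = top-exists ¬c-tdm
        t′ , d-top = top-exists ¬d-tdm
        t≡t′ = p₂ c d ¬c-tdm ¬d-tdm (inj₁ (inj₂ c⊏d))
                 (m , minAncestor∈segment m-min (inj₂ b⊏c) b<c
                    , minAncestor∈segment m-min (inj₂ b⊏d) b<d)
                 t t′ c-top d-top
        t⊑a = proj₂ c-top a (a-tdm , inj₂ a⊏c , a<c)
        t′<d = proj₂ (proj₂ (proj₁ d-top))
    in <-irrefl refl (<-≤-trans (<-trans t′<d d<a) (a-tdm t′ (subst (_⊑ a) t≡t′ t⊑a)))
    where
    a⊏c = ⊏-trans a⊏b b⊏c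
    b⊏d = ⊏-trans b⊏c c⊏d
    b<c = <-trans b<d (<-trans d<a a<c)
    a-tdm = avoids123⇒TDM avoids a⊏c a<c
    ¬c-tdm = smaller-ancestor⇒¬TDM b⊏c b<c
    ¬d-tdm = smaller-ancestor⇒¬TDM b⊏d b<d

  P₂⇒avoids3142 : Avoids F pat123 → IsP₂Forest F → Avoids F pat3142
  P₂⇒avoids3142 avoids p₂ (vs , inst) =
    no3142-in-P₂ avoids p₂ (next zero) (next (suc zero)) (next (suc (suc zero)))
      (below (suc zero) (suc (suc (suc zero))) tt)
      (below (suc (suc (suc zero))) zero tt)
      (below zero (suc (suc zero)) tt)
    where
    next  = instance⇒consecutive {π = pat3142} inst
    below = instance⇒increasing {π = pat3142} inst

  nested-tops-equal : Avoids F pat123 → Avoids F pat3142 → v ⊏ w →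
    InSegment F u v → InSegment F u w → IsTop F t v → IsTop F t′ w → t ≡ t′
  nested-tops-equal {t = t} {t′ = t′} avoids123 avoids3142 v⊏w (_ , u⊑v , _) u∈seg-w
                    v-top@((t-tdm , t⊑v , t<v) , _) w-top@((t′-tdm , _ , t′<w) , t′-highest)
    = byComparison (⊑-comparable t⊑v t′⊑v)
    where
    t′⊑v = ⊑-trans (t′-highest _ u∈seg-w) u⊑v
    ¬v-tdm = top⇒¬TDM v-top

    byComparison : Comparable F t t′ → t ≡ t′
    byComparison (inj₁ (inj₁ t≡t′)) = t≡t′
    byComparison (inj₂ (inj₁ t′≡t)) = sym t′≡t
    byComparison (inj₂ (inj₂ t′⊏t)) = ⊥-elim (avoids123
      (contains123 (TDM⊑¬TDM⇒⊏ t⊑v t-tdm ¬v-tdm) v⊏w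
        t<v (<-trans (above-top⇒> v-top t′-tdm t′⊏t) t′<w)))
    byComparison (inj₁ (inj₂ t⊏t′)) = ⊥-elim (avoids3142
      (contains3142 t⊏t′ (TDM⊑¬TDM⇒⊏ t′⊑v t′-tdm ¬v-tdm) v⊏w
        t′<w (above-top⇒> w-top t-tdm t⊏t′) t<v))

  avoids3142⇒P₂ : Avoids F pat123 → Avoids F pat3142 → IsP₂Forest F
  avoids3142⇒P₂ _ _ _ _ _ _ (inj₁ (inj₁ refl)) _ _ _ v-top w-top = top-unique v-top w-top
  avoids3142⇒P₂ _ _ _ _ _ _ (inj₂ (inj₁ refl)) _ _ _ v-top w-top = top-unique v-top w-top
  avoids3142⇒P₂ av₁ av₂ _ _ _ _ (inj₁ (inj₂ v⊏w)) (_ , u∈v , u∈w) _ _ v-top w-top =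
    nested-tops-equal av₁ av₂ v⊏w u∈v u∈w v-top w-top
  avoids3142⇒P₂ av₁ av₂ _ _ _ _ (inj₂ (inj₂ w⊏v)) (_ , u∈v , u∈w) _ _ v-top w-top =
    sym (nested-tops-equal av₁ av₂ w⊏v u∈w u∈v w-top v-top)

lemma3p15 : (F : LabeledForest) → Avoids F pat123 →
    (Avoids F pat3142 ⇔ IsP₂Forest F)
lemma3p15 F avoids123 = mk⇔ (avoids3142⇒P₂ F avoids123) (P₂⇒avoids3142 F avoids123)
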